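{- Let $(V,E)$ be an interval graph with representation $(L,<_L,f_L,f_R)$, let $v_0\,E\,v_1\,E\cdots E\,v_n$ be a path, and suppose $w\in V$ satisfies $F(w)\nless_L F(v_0)$ and $F(v_n)\nless_L F(w)$. Then $v_i\,E\,w$ for some $i\le n$; hence $v_0\,E\cdots E\,v_i\,E\,w$ and $w\,E\,v_i\,E\cdots E\,v_n$ are paths.
   Context: A graph $(V,E)$ has $E$ symmetric. An interval graph with representation $(L,<_L,f_L,f_R)$ is a reflexive graph $(V,E)$ together with a linear order $(L,<_L)$ and maps $f_L,f_R\colon V\to L$ with $f_L(v)\le_L f_R(v)$ such that, setting $F(v)=\{\ell\in L\mid f_L(v)\le_L\ell\le_L f_R(v)\}$, $v\,E\,u\iff F(v)\cap F(u)\neq\emptyset$. Notation: $F(x)<_L F(y)$ means $f_R(x)<_L f_L(y)$, and $F(x)\nless_L F(y)$ is its negation. -}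

module Defs where

open import Level using (Level; _⊔_; Lift) renaming (suc to lsuc)
open import Data.Nat using (ℕ)
open import Data.Fin using (Fin; inject₁) renaming (suc to fsuc)
open import Data.List using (List; []; _∷_)
open import Data.Product using (Σ; _×_)
open import Data.Sum using (_⊎_)
open import Data.Unit using (⊤)
open import Relation.Binary.PropositionalEquality using (_≡_)
open import Relation.Binary.Structures using (IsStrictTotalOrder)

Refl≤ : ∀ {c d} {L : Set c} → (L → L → Set d) → L → L → Set (c ⊔ d)
Refl≤ _<_ x y = (x ≡ y) ⊎ (x < y)

record IntervalGraph (a b c d : Level) : Set (lsuc (a ⊔ b ⊔ c ⊔ d)) where
  field
    V      : Set a
    E      : V → V → Set b
    E-sym  : ∀ {u v} → E u v → E v u
    E-refl : ∀ v → E v v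
    L      : Set c
    _<L_   : L → L → Set d
    <L-isStrictTotalOrder : IsStrictTotalOrder _≡_ _<L_
    fL     : V → L
    fR     : V → L
    fL≤fR  : ∀ v → Refl≤ _<L_ (fL v) (fR v)
    E⇒∩    : ∀ {u v} → E v u →
             Σ L (λ ℓ → (Refl≤ _<L_ (fL v) ℓ × Refl≤ _<L_ ℓ (fR v)) ×
                        (Refl≤ _<L_ (fL u) ℓ × Refl≤ _<L_ ℓ (fR u)))
    ∩⇒E    : ∀ {u v} →
             Σ L (λ ℓ → (Refl≤ _<L_ (fL v) ℓ × Refl≤ _<L_ ℓ (fR v)) ×
                        (Refl≤ _<L_ (fL u) ℓ × Refl≤ _<L_ ℓ (fR u))) → E v u

  -- F(x) <_L F(y)  means  f_R(x) <_L f_L(y)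
  _F<_ : V → V → Set d
  x F< y = fR x <L fL y

module _ {a b c d} (G : IntervalGraph a b c d) where
  open IntervalGraph G

  IsPath : List V → Set b
  IsPath []           = Lift b ⊤
  IsPath (x ∷ [])     = Lift b ⊤
  IsPath (x ∷ y ∷ xs) = E x y × IsPath (y ∷ xs)

{-# OPTIONS --safe #-}
module Submission where

-- Walk along the path while its intervals lie strictly to the left of F(w).
-- The first vertex vᵢ that is not strictly left of F(w) meets F(w): F(w) is not
-- strictly left of F(vᵢ) either, since for i = 0 this is the hypothesis and for
-- i > 0 the interval F(vᵢ) meets F(vᵢ₋₁), which is strictly left of F(w).  The
-- walk cannot run off the end because F(vₙ) is not strictly left of F(w).

open import Defs
open import Data.List using (List; []; _∷_; _++_; last)
open import Data.Maybe using (just)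
open import Data.Product using (Σ; _×_; _,_)
open import Data.Sum using (inj₁; inj₂)
open import Data.Empty using (⊥-elim)
open import Relation.Nullary using (¬_; yes; no)
open import Relation.Binary.PropositionalEquality using (_≡_; refl)
open import Relation.Binary.Structures using (IsStrictTotalOrder)
open import Relation.Binary.Definitions using (tri<; tri≈; tri>)

module _ {a b c d} (G : IntervalGraph a b c d) where
  open IntervalGraph G
  open IsStrictTotalOrder <L-isStrictTotalOrder using (compare; trans; irrefl; _<?_)

  _≤L_ : L → L → Set _
  _≤L_ = Refl≤ _<L_

  ≤-<-trans : ∀ {x y z} → x ≤L y → y <L z → x <L z
  ≤-<-trans (inj₁ refl) y<z = y<z
  ≤-<-trans (inj₂ x<y) y<z = trans x<y y<z

  <-≤-trans : ∀ {x y z} → x <L y → y ≤L z → x <L z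
  <-≤-trans x<y (inj₁ refl) = x<y
  <-≤-trans x<y (inj₂ y<z) = trans x<y y<z

  ≮⇒≥ : ∀ {x y} → ¬ (y <L x) → x ≤L y
  ≮⇒≥ {x} {y} y≮x with compare x y
  ... | tri< x<y _ _ = inj₂ x<y
  ... | tri≈ _ x≡y _ = inj₁ x≡y
  ... | tri> _ _ y<x = ⊥-elim (y≮x y<x)

  ¬F<∧¬F>⇒E : ∀ {u w} → ¬ (w F< u) → ¬ (u F< w) → E u w
  ¬F<∧¬F>⇒E {u} {w} w≮u u≮w with compare (fL u) (fL w)
  ... | tri< lu<lw _ _ = ∩⇒E (fL w , (inj₂ lu<lw , ≮⇒≥ u≮w) , (inj₁ refl , fL≤fR w))
  ... | tri≈ _ lu≡lw _ = ∩⇒E (fL w , (inj₁ lu≡lw , ≮⇒≥ u≮w) , (inj₁ refl , fL≤fR w))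
  ... | tri> _ _ lw<lu = ∩⇒E (fL u , (inj₁ refl , fL≤fR u) , (inj₂ lw<lu , ≮⇒≥ w≮u))

  E∧F<⇒¬F> : ∀ {u v w} → E u v → u F< w → ¬ (w F< v)
  E∧F<⇒¬F> uEv u<w w<v with E⇒∩ uEv
  ... | ℓ , (_ , ℓ≤Ru) , (Lv≤ℓ , _) =
    irrefl refl (trans (≤-<-trans Lv≤ℓ (≤-<-trans ℓ≤Ru (<-≤-trans u<w (fL≤fR _)))) w<v)

  Attachment : V → List V → Set _
  Attachment w vs = Σ (List V) (λ p → Σ V (λ vᵢ → Σ (List V) (λ s →
    (vs ≡ p ++ (vᵢ ∷ s)) ×
    E vᵢ w ×
    IsPath G (p ++ (vᵢ ∷ w ∷ [])) ×
    IsPath G (w ∷ vᵢ ∷ s))))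

  attachment-head : ∀ {w v rest} → E v w → IsPath G (v ∷ rest) → Attachment w (v ∷ rest)
  attachment-head {rest = rest} vEw path = [] , _ , rest , refl , vEw , (vEw , _) , (E-sym vEw , path)

  attachment-∷ : ∀ {w v y xs} → E v y → Attachment w (y ∷ xs) → Attachment w (v ∷ y ∷ xs)
  attachment-∷ vEy ([] , _ , s , refl , yEw , path₁ , path₂) =
    _ ∷ [] , _ , s , refl , yEw , (vEy , path₁) , path₂
  attachment-∷ vEy (_ ∷ p , vᵢ , s , refl , vᵢEw , path₁ , path₂) =
    _ ∷ _ ∷ p , vᵢ , s , refl , vᵢEw , (vEy , path₁) , path₂

  attachment : ∀ {vₙ w} v rest → last (v ∷ rest) ≡ just vₙ → IsPath G (v ∷ rest) →
               ¬ (w F< v) → ¬ (vₙ F< w) → Attachment w (v ∷ rest)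
  attachment {w = w} v rest lastEq path w≮v vₙ≮w with fR v <? fL w
  ... | no v≮w = attachment-head (¬F<∧¬F>⇒E w≮v v≮w) path
  attachment v [] refl path w≮v vₙ≮w | yes v<w = ⊥-elim (vₙ≮w v<w)
  attachment v (y ∷ xs) lastEq (vEy , path) w≮v vₙ≮w | yes v<w =
    attachment-∷ vEy (attachment y xs lastEq path (E∧F<⇒¬F> vEy v<w) vₙ≮w)

proposition2p6 : ∀ {a b c d} (G : IntervalGraph a b c d) →
    let open IntervalGraph G in
    (v₀ vₙ w : V) (rest : List V) →
    last (v₀ ∷ rest) ≡ just vₙ →
    IsPath G (v₀ ∷ rest) →
    ¬ (w F< v₀) →
    ¬ (vₙ F< w) →
    Σ (List V) (λ p → Σ V (λ vᵢ → Σ (List V) (λ s →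
      (v₀ ∷ rest ≡ p ++ (vᵢ ∷ s)) ×
      E vᵢ w ×
      IsPath G (p ++ (vᵢ ∷ w ∷ [])) ×
      IsPath G (w ∷ vᵢ ∷ s))))
proposition2p6 G v₀ vₙ w rest = attachment G v₀ rest
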